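{- Let $T$ be a finite rooted ordered tree and let $v_1,u_1$ be two children of the same node of $T$ with $v_1$ to the left of $u_1$. Then $T[v_1]\subset T^*[u_1]$.
   Context: $T[v]$ denotes the set of $v$ and its descendants in $T$; $T^*[v]$ the set of $v$ and its descendants in the dual tree $T^*$. For $T$ with root $r$, $T^*$ has the same vertex set and root $r$; with $rmc_T(u)$ the rightmost child and $ils_T(u)$ the immediate left sibling of $u$ in $T$: (1a) $r$ has no parent in $T^*$; (1b) if $v=rmc_T(r)$ then $v$ is the rightmost child of $r$ in $T^*$; (2) if $v=rmc_T(u)$ with $u\ne r$, then $v$ is the immediate left sibling of $u$ in $T^*$; (3) if $v=ils_T(u)$, then $v$ is the rightmost child of $u$ in $T^*$. -}

module Defs where

open import Data.Nat using (ℕ; suc; _<_)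
open import Data.Fin using (Fin; fromℕ<)
open import Data.List using (List; []; _∷_; _∷ʳ_; _++_)
open import Data.Product using (Σ; ∃; ∃-syntax; _×_)
open import Data.Unit using (⊤)
open import Relation.Nullary using (¬_)
open import Relation.Binary.PropositionalEquality using (_≡_; _≢_)

-- A finite rooted ordered tree: a node with n children, ordered
-- left-to-right as f 0, f 1, ..., f (n-1).
data Tree : Set where
  node : (n : ℕ) → (Fin n → Tree) → Tree

-- Vertices are addressed by their path from the root: the list of
-- (0-based, left-to-right) child indices.  The root is [].
Vertex : Set
Vertex = List ℕ

Valid : Tree → Vertex → Set
Valid t [] = ⊤
Valid (node n f) (i ∷ p) = Σ (i < n) λ h → Valid (f (fromℕ< h)) p

RMC : Tree → Vertex → Vertex → Set
RMC T u v = ∃[ i ] (v ≡ u ∷ʳ i × Valid T v × ¬ Valid T (u ∷ʳ suc i))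

ILS : Tree → Vertex → Vertex → Set
ILS T u v = ∃[ p ] ∃[ i ] (v ≡ p ∷ʳ i × u ≡ p ∷ʳ suc i × Valid T v × Valid T u)

SubT : Tree → Vertex → Vertex → Set
SubT T v w = Valid T w × ∃[ s ] (w ≡ v ++ s)

-- Parent/child relation of the dual tree T* (root []), exactly as
-- given by rules (1b), (2), (3):  ChildStar T p c  means  c is a child
-- of p in T*.
data ChildStar (T : Tree) : Vertex → Vertex → Set where
  rule1b : ∀ {v} → RMC T [] v → ChildStar T [] v
  rule3  : ∀ {u v} → ILS T u v → ChildStar T u v
  -- (2) v = rmc_T(u), u ≠ r  ⇒  v is the immediate left sibling of u
  --     in T*, hence has the same T*-parent as u
  rule2  : ∀ {p u v} → RMC T u v → u ≢ [] → ChildStar T p u → ChildStar T p v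

data SubTStar (T : Tree) (u : Vertex) : Vertex → Set where
  here : Valid T u → SubTStar T u u
  step : ∀ {w x} → SubTStar T u w → ChildStar T w x → SubTStar T u x

module Submission where

open import Defs
open import Data.Nat using (ℕ; suc; _<_; _≤_; _≤‴_; ≤‴-refl; ≤‴-step; s≤s)
open import Data.Nat.Properties
  using (<-irrelevant; <-irrefl; ≤-trans; ≤-refl; n≤1+n; m≤n⇒m<n∨m≡n; ≤⇒≤‴)
open import Data.List using (List; []; _∷_; _∷ʳ_; _++_; [_])
open import Data.List.Properties using (++-assoc; ++-identityʳ)
open import Data.Fin using (fromℕ<)
open import Data.Product using (∃-syntax; _×_; _,_)
open import Data.Sum using (inj₁; inj₂)
open import Data.Unit using (tt)
open import Relation.Nullary using (¬_)
open import Relation.Binary.PropositionalEquality using (_≡_; _≢_; refl; sym; subst)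

-- If x is a T*-child of y, then so is rmc_T(x) (rule 2), and every other
-- child x·m of x lies below rmc_T(x) in T* along the chain of immediate left
-- siblings (rule 3).  By induction along the path from x, T[x] ⊆ T*[y].  Finally
-- p·i is the T*-child of p·(i+1), which lies below p·j on the same sibling chain.

valid-prefix : ∀ T x s → Valid T (x ++ s) → Valid T x
valid-prefix T          []      s _       = tt
valid-prefix (node n f) (a ∷ x) s (h , v) = h , valid-prefix (f (fromℕ< h)) x s v

valid-leftSibling : ∀ T x {k j} → k ≤ j → Valid T (x ∷ʳ j) → Valid T (x ∷ʳ k)
valid-leftSibling (node n f) []      k≤j (h , _) = ≤-trans (s≤s k≤j) h , tt
valid-leftSibling (node n f) (a ∷ x) k≤j (h , v) = h , valid-leftSibling (f (fromℕ< h)) x k≤j v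

lastSibling : ∀ T x {m} → Valid T (x ∷ʳ m) →
  ∃[ M ] (m ≤ M × Valid T (x ∷ʳ M) × ¬ Valid T (x ∷ʳ suc M))
lastSibling (node (suc n) f) [] (s≤s m≤n , _) =
  n , m≤n , (≤-refl , tt) , λ { (n<n , _) → <-irrefl refl n<n }
lastSibling (node n f) (a ∷ x) (h , v) with lastSibling (f (fromℕ< h)) x v
... | M , m≤M , vM , ¬vsM =
  M , m≤M , (h , vM) ,
  λ { (h′ , v′) → ¬vsM (subst (λ a<n → Valid (f (fromℕ< a<n)) (x ∷ʳ suc M)) (<-irrelevant h′ h) v′) }

rightmostSibling : ∀ T x {m} → Valid T (x ∷ʳ m) → ∃[ M ] (m ≤ M × RMC T x (x ∷ʳ M))
rightmostSibling T x vm with lastSibling T x vm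
... | M , m≤M , vM , ¬vsM = M , m≤M , M , refl , vM , ¬vsM

∷ʳ≢[] : ∀ (x : List ℕ) a → x ∷ʳ a ≢ []
∷ʳ≢[] []      a ()
∷ʳ≢[] (_ ∷ _) a ()

childStar-nonRoot : ∀ {T y x} → ChildStar T y x → x ≢ []
childStar-nonRoot (rule1b (i , refl , _))            = ∷ʳ≢[] [] i
childStar-nonRoot (rule3 (p , i , refl , _))         = ∷ʳ≢[] p i
childStar-nonRoot (rule2 {u = u} (i , refl , _) _ _) = ∷ʳ≢[] u i

childStar-validParent : ∀ {T y x} → ChildStar T y x → Valid T y
childStar-validParent (rule1b _)                       = tt
childStar-validParent (rule3 (_ , _ , _ , _ , _ , vu)) = vu
childStar-validParent (rule2 _ _ c)                    = childStar-validParent c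

childStar-valid : ∀ {T y x} → ChildStar T y x → Valid T x
childStar-valid (rule1b (_ , _ , vx , _))        = vx
childStar-valid (rule3 (_ , _ , _ , _ , vx , _)) = vx
childStar-valid (rule2 (_ , _ , vx , _) _ _)     = vx

subTStar-valid : ∀ {T u w} → SubTStar T u w → Valid T w
subTStar-valid (here vu)  = vu
subTStar-valid (step _ c) = childStar-valid c

subTStar-trans : ∀ {T u w z} → SubTStar T u w → SubTStar T w z → SubTStar T u z
subTStar-trans u⊇w (here _)     = u⊇w
subTStar-trans u⊇w (step w⊇z c) = step (subTStar-trans u⊇w w⊇z) c

ils-pred : ∀ T x k → Valid T (x ∷ʳ suc k) → ILS T (x ∷ʳ suc k) (x ∷ʳ k)
ils-pred T x k vsk = x , k , refl , refl , valid-leftSibling T x (n≤1+n k) vsk , vsk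

leftSiblings-⊆-dual : ∀ T x {k j} → k ≤ j → Valid T (x ∷ʳ j) → SubTStar T (x ∷ʳ j) (x ∷ʳ k)
leftSiblings-⊆-dual T x {j = j} k≤j vj = go (≤⇒≤‴ k≤j)
  where
  go : ∀ {k} → k ≤‴ j → SubTStar T (x ∷ʳ j) (x ∷ʳ k)
  go ≤‴-refl             = here vj
  go {k} (≤‴-step sk≤‴j) = step j⊇sk (rule3 (ils-pred T x k (subTStar-valid j⊇sk)))
    where
    j⊇sk : SubTStar T (x ∷ʳ j) (x ∷ʳ suc k)
    j⊇sk = go sk≤‴j

child-dualParent : ∀ {T y x m} → ChildStar T y x → Valid T (x ∷ʳ m) →
  ∃[ z ] (SubTStar T y z × ChildStar T z (x ∷ʳ m))
child-dualParent {T} {y} {x} {m} c vm with rightmostSibling T x vm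
... | M , m≤M , rmc with m≤n⇒m<n∨m≡n m≤M
...   | inj₂ refl = y , here (childStar-validParent c) , rule2 rmc (childStar-nonRoot c) c
...   | inj₁ m<M  =
  x ∷ʳ suc m ,
  subTStar-trans y⊇M (leftSiblings-⊆-dual T x m<M (childStar-valid rmcChild)) ,
  rule3 (ils-pred T x m (valid-leftSibling T x m<M (childStar-valid rmcChild)))
  where
  rmcChild : ChildStar T y (x ∷ʳ M)
  rmcChild = rule2 rmc (childStar-nonRoot c) c
  y⊇M : SubTStar T y (x ∷ʳ M)
  y⊇M = step (here (childStar-validParent c)) rmcChild

descendants-⊆-dual : ∀ {T y x} → ChildStar T y x →
  ∀ s → Valid T (x ++ s) → SubTStar T y (x ++ s)
descendants-⊆-dual {T} {y} {x} c [] _ rewrite ++-identityʳ x =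
  step (here (childStar-validParent c)) c
descendants-⊆-dual {T} {y} {x} c (m ∷ s) v =
  subst (SubTStar T y) (++-assoc x [ m ] s)
    (viaDualParent (child-dualParent c (valid-prefix T (x ∷ʳ m) s v′)))
  where
  v′ : Valid T ((x ∷ʳ m) ++ s)
  v′ = subst (Valid T) (sym (++-assoc x [ m ] s)) v

  viaDualParent : ∃[ z ] (SubTStar T y z × ChildStar T z (x ∷ʳ m)) → SubTStar T y ((x ∷ʳ m) ++ s)
  viaDualParent (z , y⊇z , z→xm) = subTStar-trans y⊇z (descendants-⊆-dual z→xm s v′)

lemma4 : (T : Tree) (p : Vertex) (i j : ℕ) → i < j → Valid T (p ∷ʳ j) →
    ∀ w → SubT T (p ∷ʳ i) w → SubTStar T (p ∷ʳ j) w
lemma4 T p i j i<j vj w (vw , s , refl) =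
  subTStar-trans j⊇si
    (descendants-⊆-dual (rule3 (ils-pred T p i (subTStar-valid j⊇si))) s vw)
  where
  j⊇si : SubTStar T (p ∷ʳ j) (p ∷ʳ suc i)
  j⊇si = leftSiblings-⊆-dual T p i<j vj
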